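{- Let $G=(V,E)$ be a connected graph on $n$ vertices of maximum degree at most $\Delta$, and let $s$ be a positive integer. Let $B$ be the set of vertex pairs $\{a,b\}\subseteq V$ with $\delta(a,b)\ge2$ and $|D(a,b)|\le 3n\cdot(\log n)/s$, and for $a\in V$ let $B(a)=\{b\in V:\{a,b\}\in B\}$. Then for every vertex $a\in V$, $|B(a)|\le 9\Delta^3\cdot n^2\cdot(\log^2 n)/s^2$.
   Context: $\delta$ is the shortest-path distance in $G$. For distinct vertices $a,b$, a vertex $u$ distinguishes $a$ and $b$ if $|\delta(u,a)-\delta(u,b)|>1$, and $D(a,b)$ is the set of vertices distinguishing $a$ and $b$. -}

module Defs where

open import Data.Bool using (Bool; true; false; _∧_; _∨_; not; T)
open import Data.Nat as ℕ using (ℕ; zero; suc; _≤_; ∣_-_∣; _!)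
open import Data.Nat.Properties using (_!≢0)
open import Data.Fin using (Fin)
open import Data.List using (List; upTo; allFin; filter; length)
open import Data.Bool.ListAction using (any)
open import Data.Product using (∃)
open import Data.Integer using (+_)
open import Data.Rational as ℚ using (ℚ; _/_; 0ℚ; 1ℚ)
open import Relation.Binary.PropositionalEquality using (_≡_)
open import Relation.Nullary using (¬_)
open import Relation.Nullary.Decidable using (does)

record Graph (n : ℕ) : Set where
  field
    adj   : Fin n → Fin n → Bool
    sym   : ∀ u v → adj u v ≡ adj v u
    irrefl : ∀ v → adj v v ≡ false

open Graph public

_==_ : ∀ {n} → Fin n → Fin n → Bool
u == v = does (u Data.Fin.≟ v)

count : ∀ {A : Set} → (A → Bool) → List A → ℕ
count p xs = length (filter (λ x → T? (p x)) xs)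
  where
  open import Data.Bool.Properties using (T?)

deg : ∀ {n} → Graph n → Fin n → ℕ
deg {n} G v = count (λ w → adj G v w) (allFin n)

MaxDegreeAtMost : ∀ {n} → Graph n → ℕ → Set
MaxDegreeAtMost G Δ = ∀ v → deg G v ≤ Δ

reach : ∀ {n} → Graph n → ℕ → Fin n → Fin n → Bool
reach G zero    u v = u == v
reach {n} G (suc k) u v = reach G k u v ∨ any (λ w → reach G k u w ∧ adj G w v) (allFin n)

Connected : ∀ {n} → Graph n → Set
Connected G = ∀ u v → ∃ λ k → reach G k u v ≡ true

-- In a connected graph on
-- n vertices every distance is < n, so this is exactly the least k with
-- reach G k u v ≡ true, i.e. the usual graph distance.
δ : ∀ {n} → Graph n → Fin n → Fin n → ℕ
δ {n} G u v = count (λ k → not (reach G k u v)) (upTo n)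

distinguishes : ∀ {n} → Graph n → Fin n → Fin n → Fin n → Bool
distinguishes G u a b = does (2 ℕ.≤? ∣ δ G u a - δ G u b ∣)

∣D∣ : ∀ {n} → Graph n → Fin n → Fin n → ℕ
∣D∣ {n} G a b = count (λ u → distinguishes G u a b) (allFin n)

pow : ℚ → ℕ → ℚ
pow q zero    = 1ℚ
pow q (suc j) = q ℚ.* pow q j

expPartial : ℚ → ℕ → ℚ
expPartial q zero    = 0ℚ
expPartial q (suc m) = expPartial q m ℚ.+ (pow q m ℚ.* ((+ 1 / (m !)) {{m !≢0}}))

-- ExpLe q N  means  e^q ≤ N, for q ≥ 0 (all terms of the exponential series
-- are then nonnegative, so e^q is the supremum of the partial sums).
-- Equivalently (for N ≥ 1):  q ≤ ln N.
ExpLe : ℚ → ℕ → Set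
ExpLe q N = ∀ m → expPartial q m ℚ.≤ (+ N / 1)

ℕ→ℚ : ℕ → ℚ
ℕ→ℚ k = + k / 1

-- The bad pairs of the lemma.
-- b ∈ B(a)  iff  δ(a,b) ≥ 2  and  |D(a,b)| ≤ 3 n (ln n) / s.
-- For n ≥ 1 and s ≥ 1 the latter is equivalent to  s·|D(a,b)| ≤ ln (n^(3n)),
-- i.e. e^(s·|D(a,b)|) ≤ n^(3n).
InB : ∀ {n} → Graph n → ℕ → Fin n → Fin n → Set
InB {n} G s a b = (2 ≤ δ G a b) Data.Product.× ExpLe (ℕ→ℚ (s ℕ.* ∣D∣ G a b)) (n ℕ.^ (3 ℕ.* n))

-- Let c ∈ B(a) be farthest from a and M = max {|D(a,b)| : b ∈ B(a)}. Every y with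
-- 2δ(a,y) + 2 ≤ δ(a,c) distinguishes a and c, and so does c itself, so fewer than M
-- such y exist. For b ∈ B(a) with δ(a,b) ≥ 3, a geodesic from a to b contains a vertex z
-- just past its midpoint and, three steps closer to a, such a vertex y. If b and b′
-- share z then b distinguishes a and b′, so each z serves at most M vertices of B(a).
-- With at most Δ³ vertices at distance 3 from each y and at most Δ² at distance 2 from a,
-- |B(a)| ≤ Δ² + (M − 1)Δ³M ≤ Δ³M², and s·M ≤ 3n ln n gives the bound. The logarithm is
-- handled through partial sums of the exponential series: e^(3nq) ≤ e^(sM) ≤ n^(3n)
-- yields e^q ≤ n by the Cauchy-product inequality E_m(x) E_p(y) ≤ E_(m+p)(x + y) for
-- truncated exponentials.

module Submission where

open import Defs
open import Data.Nat using (ℕ; _≤_; _*_; _^_)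
open import Data.Fin using (Fin)
open import Data.List using (List; length)
open import Data.List.Relation.Unary.All using (All)
open import Data.List.Relation.Unary.Unique.Propositional using (Unique)
open import Data.Rational as ℚ using (ℚ; 0ℚ)

open import Data.Bool using (Bool; true; false; T; _∧_; _∨_; not)
open import Data.Bool.ListAction using (any)
open import Data.Bool.Properties using (T-∧; T-∨; T-≡)
open import Data.Empty using (⊥-elim)
import Data.Fin as Fin
open import Data.Integer as ℤ using (+_)
import Data.Integer.Properties as ℤP
open import Data.List using ([]; _∷_; _++_; allFin; upTo; filter)
import Data.List.Properties as LP
open import Data.List.Extrema.Nat using (argmax; argmax-all; f[⊥]≤f[argmax]; f[xs]≤f[argmax])
open import Data.List.Membership.Propositional using (_∈_; lose)
open import Data.List.Membership.Propositional.Properties using (∈-allFin)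
import Data.List.Relation.Unary.All as All
open import Data.List.Relation.Unary.AllPairs using (_∷_)
open import Data.List.Relation.Unary.Any using (here; there; satisfied)
open import Data.List.Relation.Unary.Any.Properties using (any⁺; any⁻)
open import Data.Nat as ℕ using (zero; suc; _+_; _∸_; _<_; _!; z≤n; s≤s; NonZero)
import Data.Nat.Properties as ℕP
open import Data.Nat.Properties using (_!≢0)
open import Data.Nat.Solver using () renaming (module +-*-Solver to NatSolver)
open import Data.Product as Product using (∃; _×_; _,_; proj₁; proj₂)
open import Data.Rational using (1ℚ; _/_; toℚᵘ)
import Data.Rational.Properties as ℚP
open import Data.Rational.Solver using (module +-*-Solver)
import Data.Rational.Unnormalised as ℚᵘ
import Data.Rational.Unnormalised.Properties as ℚᵘP
open import Data.Sum using (_⊎_; inj₁; inj₂)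
open import Data.Unit using (tt)
open import Function using (id; _∘_; _⇔_; mk⇔; Equivalence)
open import Relation.Binary.PropositionalEquality as ≡ hiding (sym)
open import Relation.Nullary using (¬_; yes; no)
open import Relation.Nullary.Decidable using (T?)

-- Rational arithmetic

ℕ→ℚ-toℚᵘ : ∀ k → toℚᵘ (ℕ→ℚ k) ℚᵘ.≃ ℚᵘ.mkℚᵘ (+ k) 0
ℕ→ℚ-toℚᵘ k = ℚP.toℚᵘ-fromℚᵘ (ℚᵘ.mkℚᵘ (+ k) 0)

ℕ→ℚ-homo-+ : ∀ a b → ℕ→ℚ (a + b) ≡ ℕ→ℚ a ℚ.+ ℕ→ℚ b
ℕ→ℚ-homo-+ a b = ℚP.toℚᵘ-injective (begin
  toℚᵘ (ℕ→ℚ (a + b))                         ≈⟨ ℕ→ℚ-toℚᵘ (a + b) ⟩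
  ℚᵘ.mkℚᵘ (+ (a + b)) 0                      ≈⟨ ℚᵘ.*≡* (cong (ℤ._* + 1) eq) ⟩
  ℚᵘ.mkℚᵘ (+ a) 0 ℚᵘ.+ ℚᵘ.mkℚᵘ (+ b) 0        ≈⟨ ℚᵘP.+-cong (ℚᵘP.≃-sym (ℕ→ℚ-toℚᵘ a)) (ℚᵘP.≃-sym (ℕ→ℚ-toℚᵘ b)) ⟩
  toℚᵘ (ℕ→ℚ a) ℚᵘ.+ toℚᵘ (ℕ→ℚ b)             ≈⟨ ℚᵘP.≃-sym (ℚP.toℚᵘ-homo-+ (ℕ→ℚ a) (ℕ→ℚ b)) ⟩
  toℚᵘ (ℕ→ℚ a ℚ.+ ℕ→ℚ b)                     ∎)
  where
  open ℚᵘP.≃-Reasoning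
  eq : + (a + b) ≡ + a ℤ.* + 1 ℤ.+ + b ℤ.* + 1
  eq = trans (ℤP.pos-+ a b) (≡.sym (cong₂ ℤ._+_ (ℤP.*-identityʳ (+ a)) (ℤP.*-identityʳ (+ b))))

ℕ→ℚ-homo-* : ∀ a b → ℕ→ℚ (a * b) ≡ ℕ→ℚ a ℚ.* ℕ→ℚ b
ℕ→ℚ-homo-* a b = ℚP.toℚᵘ-injective (begin
  toℚᵘ (ℕ→ℚ (a * b))                         ≈⟨ ℕ→ℚ-toℚᵘ (a * b) ⟩
  ℚᵘ.mkℚᵘ (+ (a * b)) 0                      ≈⟨ ℚᵘ.*≡* (cong (ℤ._* + 1) (ℤP.pos-* a b)) ⟩
  ℚᵘ.mkℚᵘ (+ a) 0 ℚᵘ.* ℚᵘ.mkℚᵘ (+ b) 0        ≈⟨ ℚᵘP.*-cong (ℚᵘP.≃-sym (ℕ→ℚ-toℚᵘ a)) (ℚᵘP.≃-sym (ℕ→ℚ-toℚᵘ b)) ⟩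
  toℚᵘ (ℕ→ℚ a) ℚᵘ.* toℚᵘ (ℕ→ℚ b)             ≈⟨ ℚᵘP.≃-sym (ℚP.toℚᵘ-homo-* (ℕ→ℚ a) (ℕ→ℚ b)) ⟩
  toℚᵘ (ℕ→ℚ a ℚ.* ℕ→ℚ b)                     ∎)
  where open ℚᵘP.≃-Reasoning

ℕ→ℚ-mono-≤ : ∀ {a b} → a ≤ b → ℕ→ℚ a ℚ.≤ ℕ→ℚ b
ℕ→ℚ-mono-≤ {a} {b} a≤b = ℚP.toℚᵘ-cancel-≤ (begin
  toℚᵘ (ℕ→ℚ a)     ≃⟨ ℕ→ℚ-toℚᵘ a ⟩
  ℚᵘ.mkℚᵘ (+ a) 0  ≤⟨ ℚᵘ.*≤* (ℤP.*-monoʳ-≤-nonNeg (+ 1) (ℤ.+≤+ a≤b)) ⟩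
  ℚᵘ.mkℚᵘ (+ b) 0  ≃⟨ ℚᵘP.≃-sym (ℕ→ℚ-toℚᵘ b) ⟩
  toℚᵘ (ℕ→ℚ b)     ∎)
  where open ℚᵘP.≤-Reasoning

ℕ→ℚ-nonNeg : ∀ k → 0ℚ ℚ.≤ ℕ→ℚ k
ℕ→ℚ-nonNeg k = ℕ→ℚ-mono-≤ {0} {k} z≤n

ℕ→ℚ-pos : ∀ k → 0ℚ ℚ.< ℕ→ℚ (suc k)
ℕ→ℚ-pos k = ℚP.positive⁻¹ (ℕ→ℚ (suc k)) {{ℚP.normalize-pos (suc k) 1}}

ℕ→ℚ*1/n≡1 : ∀ m .{{_ : NonZero m}} → ℕ→ℚ m ℚ.* (+ 1 / m) ≡ 1ℚ
ℕ→ℚ*1/n≡1 (suc m) = ℚP.toℚᵘ-injective (begin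
  toℚᵘ (ℕ→ℚ (suc m) ℚ.* (+ 1 / suc m))         ≈⟨ ℚP.toℚᵘ-homo-* (ℕ→ℚ (suc m)) (+ 1 / suc m) ⟩
  toℚᵘ (ℕ→ℚ (suc m)) ℚᵘ.* toℚᵘ (+ 1 / suc m)   ≈⟨ ℚᵘP.*-cong (ℕ→ℚ-toℚᵘ (suc m)) (ℚP.toℚᵘ-fromℚᵘ (ℚᵘ.mkℚᵘ (+ 1) m)) ⟩
  ℚᵘ.mkℚᵘ (+ suc m) 0 ℚᵘ.* ℚᵘ.mkℚᵘ (+ 1) m      ≈⟨ ℚᵘ.*≡* (cong (λ k → + suc k) m*1*1≡m+0+0) ⟩
  toℚᵘ 1ℚ                                      ∎)
  where
  open ℚᵘP.≃-Reasoning
  m*1*1≡m+0+0 : m * 1 * 1 ≡ m + 0 + 0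
  m*1*1≡m+0+0 = solve 1 (λ m → m :* con 1 :* con 1 := m :+ con 0 :+ con 0) refl m
    where open NatSolver

ℕ→ℚ-homo-^ : ∀ N j → ℕ→ℚ (N ^ j) ≡ pow (ℕ→ℚ N) j
ℕ→ℚ-homo-^ N zero    = refl
ℕ→ℚ-homo-^ N (suc j) = trans (ℕ→ℚ-homo-* N (N ^ j)) (cong (ℕ→ℚ N ℚ.*_) (ℕ→ℚ-homo-^ N j))

*-nonNeg : ∀ {p q} → 0ℚ ℚ.≤ p → 0ℚ ℚ.≤ q → 0ℚ ℚ.≤ p ℚ.* q
*-nonNeg {p} {q} 0≤p 0≤q =
  ℚP.nonNegative⁻¹ (p ℚ.* q) {{ℚP.nonNeg*nonNeg⇒nonNeg p {{ℚ.nonNegative 0≤p}} q {{ℚ.nonNegative 0≤q}}}}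

*-mono-≤-nonNeg : ∀ {p p′ q q′} → 0ℚ ℚ.≤ p′ → 0ℚ ℚ.≤ q → p ℚ.≤ p′ → q ℚ.≤ q′ → p ℚ.* q ℚ.≤ p′ ℚ.* q′
*-mono-≤-nonNeg {p} {p′} {q} 0≤p′ 0≤q p≤p′ q≤q′ = ℚP.≤-trans
  (ℚP.*-monoʳ-≤-nonNeg q {{ℚ.nonNegative 0≤q}} p≤p′)
  (ℚP.*-monoˡ-≤-nonNeg p′ {{ℚ.nonNegative 0≤p′}} q≤q′)

*-cancelˡ-≡-pos : ∀ r {p q} → 0ℚ ℚ.< r → r ℚ.* p ≡ r ℚ.* q → p ≡ q
*-cancelˡ-≡-pos r 0<r rp≡rq = ℚP.≤-antisym
  (ℚP.*-cancelˡ-≤-pos r {{ℚ.positive 0<r}} (ℚP.≤-reflexive rp≡rq))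
  (ℚP.*-cancelˡ-≤-pos r {{ℚ.positive 0<r}} (ℚP.≤-reflexive (≡.sym rp≡rq)))

pow-nonNeg : ∀ {x} → 0ℚ ℚ.≤ x → ∀ j → 0ℚ ℚ.≤ pow x j
pow-nonNeg 0≤x zero    = ℚP.<⇒≤ (ℚP.positive⁻¹ 1ℚ)
pow-nonNeg 0≤x (suc j) = *-nonNeg 0≤x (pow-nonNeg 0≤x j)

pow-mono-≤ : ∀ {x y} → 0ℚ ℚ.≤ x → x ℚ.≤ y → ∀ j → pow x j ℚ.≤ pow y j
pow-mono-≤ 0≤x x≤y zero    = ℚP.≤-refl
pow-mono-≤ 0≤x x≤y (suc j) =
  *-mono-≤-nonNeg (ℚP.≤-trans 0≤x x≤y) (pow-nonNeg 0≤x j) x≤y (pow-mono-≤ 0≤x x≤y j)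

pow-pos : ∀ {x} → 0ℚ ℚ.< x → ∀ j → 0ℚ ℚ.< pow x j
pow-pos 0<x zero    = ℚP.positive⁻¹ 1ℚ
pow-pos {x} 0<x (suc j) =
  ℚP.positive⁻¹ (x ℚ.* pow x j) {{ℚP.pos*pos⇒pos x {{ℚ.positive 0<x}} (pow x j) {{ℚ.positive (pow-pos 0<x j)}}}}

pow-mono-< : ∀ {x y} → 0ℚ ℚ.≤ x → x ℚ.< y → ∀ j → pow x (suc j) ℚ.< pow y (suc j)
pow-mono-< {x} {y} 0≤x x<y j = ℚP.≤-<-trans
  (ℚP.*-monoˡ-≤-nonNeg x {{ℚ.nonNegative 0≤x}} (pow-mono-≤ 0≤x (ℚP.<⇒≤ x<y) j))
  (ℚP.*-monoˡ-<-pos (pow y j) {{ℚ.positive (pow-pos (ℚP.≤-<-trans 0≤x x<y) j)}} x<y)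

-- Truncated exponential series

∑ : ℕ → (ℕ → ℚ) → ℚ
∑ zero    f = 0ℚ
∑ (suc m) f = ∑ m f ℚ.+ f m

∑-cong : ∀ m {f g : ℕ → ℚ} → (∀ {i} → i < m → f i ≡ g i) → ∑ m f ≡ ∑ m g
∑-cong zero    f≡g = refl
∑-cong (suc m) f≡g = cong₂ ℚ._+_ (∑-cong m (λ i<m → f≡g (ℕP.m<n⇒m<1+n i<m))) (f≡g ℕP.≤-refl)

∑-distrib-+ : ∀ m (f g : ℕ → ℚ) → ∑ m (λ i → f i ℚ.+ g i) ≡ ∑ m f ℚ.+ ∑ m g
∑-distrib-+ zero    f g = refl
∑-distrib-+ (suc m) f g rewrite ∑-distrib-+ m f g =
  solve 4 (λ a b c d → (a :+ b) :+ (c :+ d) := (a :+ c) :+ (b :+ d)) refl (∑ m f) (∑ m g) (f m) (g m)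
  where open +-*-Solver

∑-*ˡ : ∀ m c (f : ℕ → ℚ) → ∑ m (λ i → c ℚ.* f i) ≡ c ℚ.* ∑ m f
∑-*ˡ zero    c f = ≡.sym (ℚP.*-zeroʳ c)
∑-*ˡ (suc m) c f rewrite ∑-*ˡ m c f = ≡.sym (ℚP.*-distribˡ-+ c (∑ m f) (f m))

∑-*ʳ : ∀ m c (f : ℕ → ℚ) → ∑ m (λ i → f i ℚ.* c) ≡ ∑ m f ℚ.* c
∑-*ʳ m c f = trans (∑-cong m (λ {i} _ → ℚP.*-comm (f i) c)) (trans (∑-*ˡ m c f) (ℚP.*-comm c (∑ m f)))

∑-suc : ∀ m (f : ℕ → ℚ) → ∑ (suc m) f ≡ f 0 ℚ.+ ∑ m (λ i → f (suc i))
∑-suc zero    f = trans (ℚP.+-identityˡ (f 0)) (≡.sym (ℚP.+-identityʳ (f 0)))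
∑-suc (suc m) f rewrite ∑-suc m f = ℚP.+-assoc (f 0) (∑ m (λ i → f (suc i))) (f (suc m))

∑-mono-≤ : ∀ m {f g : ℕ → ℚ} → (∀ {i} → i < m → f i ℚ.≤ g i) → ∑ m f ℚ.≤ ∑ m g
∑-mono-≤ zero    f≤g = ℚP.≤-refl
∑-mono-≤ (suc m) f≤g = ℚP.+-mono-≤ (∑-mono-≤ m (λ i<m → f≤g (ℕP.m<n⇒m<1+n i<m))) (f≤g ℕP.≤-refl)

∑-nonNeg : ∀ m {f : ℕ → ℚ} → (∀ i → 0ℚ ℚ.≤ f i) → 0ℚ ℚ.≤ ∑ m f
∑-nonNeg zero    0≤f = ℚP.≤-refl
∑-nonNeg (suc m) 0≤f = ℚP.+-mono-≤ (∑-nonNeg m 0≤f) (0≤f m)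

∑-monoˡ-≤ : ∀ {f : ℕ → ℚ} → (∀ i → 0ℚ ℚ.≤ f i) → ∀ {m m′} → m ≤ m′ → ∑ m f ℚ.≤ ∑ m′ f
∑-monoˡ-≤ {f} 0≤f m≤m′ = go (ℕP.≤⇒≤′ m≤m′)
  where
  go : ∀ {m m′} → m ℕ.≤′ m′ → ∑ m f ℚ.≤ ∑ m′ f
  go ℕ.≤′-refl                 = ℚP.≤-refl
  go (ℕ.≤′-step {m′} m≤′m′) = ℚP.≤-trans (go m≤′m′)
    (ℚP.≤-trans (ℚP.≤-reflexive (≡.sym (ℚP.+-identityʳ (∑ m′ f)))) (ℚP.+-monoʳ-≤ (∑ m′ f) (0≤f m′)))

1/_! : ℕ → ℚ
1/ j ! = (+ 1 / (j !)) {{j !≢0}}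

[1+j]*1/[1+j]!≡1/j! : ∀ j → ℕ→ℚ (suc j) ℚ.* 1/ suc j ! ≡ 1/ j !
[1+j]*1/[1+j]!≡1/j! j = begin
  K ℚ.* 1/ suc j !                           ≡⟨ ≡.sym (ℚP.*-identityˡ _) ⟩
  1ℚ ℚ.* (K ℚ.* 1/ suc j !)                  ≡⟨ cong (ℚ._* (K ℚ.* 1/ suc j !)) (≡.sym (n*1/n! j)) ⟩
  (F ℚ.* 1/ j !) ℚ.* (K ℚ.* 1/ suc j !)      ≡⟨ solve 4 (λ k c′ f c → (f :* c) :* (k :* c′) := c :* ((k :* f) :* c′)) refl K (1/ suc j !) F (1/ j !) ⟩
  1/ j ! ℚ.* ((K ℚ.* F) ℚ.* 1/ suc j !)      ≡⟨ cong (λ z → 1/ j ! ℚ.* (z ℚ.* 1/ suc j !)) (≡.sym (ℕ→ℚ-homo-* (suc j) (j !))) ⟩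
  1/ j ! ℚ.* (ℕ→ℚ (suc j !) ℚ.* 1/ suc j !)  ≡⟨ cong (1/ j ! ℚ.*_) (n*1/n! (suc j)) ⟩
  1/ j ! ℚ.* 1ℚ                              ≡⟨ ℚP.*-identityʳ _ ⟩
  1/ j !                                     ∎
  where
  open ≡-Reasoning
  open +-*-Solver
  K F : ℚ
  K = ℕ→ℚ (suc j)
  F = ℕ→ℚ (j !)
  n*1/n! : ∀ j → ℕ→ℚ (j !) ℚ.* 1/ j ! ≡ 1ℚ
  n*1/n! j = ℕ→ℚ*1/n≡1 (j !) {{j !≢0}}

expTerm : ℚ → ℕ → ℚ
expTerm x j = pow x j ℚ.* 1/ j !

expPartial≡∑ : ∀ x m → expPartial x m ≡ ∑ m (expTerm x)
expPartial≡∑ x zero    = refl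
expPartial≡∑ x (suc m) = cong (ℚ._+ expTerm x m) (expPartial≡∑ x m)

expTerm-rec : ∀ x j → ℕ→ℚ (suc j) ℚ.* expTerm x (suc j) ≡ x ℚ.* expTerm x j
expTerm-rec x j = trans
  (solve 4 (λ k x p c → k :* ((x :* p) :* c) := x :* (p :* (k :* c))) refl (ℕ→ℚ (suc j)) x (pow x j) (1/ suc j !))
  (cong (λ z → x ℚ.* (pow x j ℚ.* z)) ([1+j]*1/[1+j]!≡1/j! j))
  where open +-*-Solver

expTerm-nonNeg : ∀ {x} → 0ℚ ℚ.≤ x → ∀ j → 0ℚ ℚ.≤ expTerm x j
expTerm-nonNeg 0≤x j = *-nonNeg (pow-nonNeg 0≤x j) (ℚP.nonNegative⁻¹ (1/ j !) {{ℚP.normalize-nonNeg 1 (j !) {{j !≢0}}}})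

expTerm-mono-≤ : ∀ {x y} → 0ℚ ℚ.≤ x → x ℚ.≤ y → ∀ j → expTerm x j ℚ.≤ expTerm y j
expTerm-mono-≤ 0≤x x≤y j = ℚP.*-monoʳ-≤-nonNeg (1/ j !) {{ℚP.normalize-nonNeg 1 (j !) {{j !≢0}}}} (pow-mono-≤ 0≤x x≤y j)

conv : (ℕ → ℚ) → (ℕ → ℚ) → ℕ → ℚ
conv f g t = ∑ (suc t) (λ i → f i ℚ.* g (t ∸ i))

-- The recurrences say f j = x^j/j! · f 0 and g j = y^j/j! · g 0; their convolution satisfies
-- the recurrence for x + y, which is the binomial theorem for the exponential series.
module _ {f g : ℕ → ℚ} {x y : ℚ}
         (f-rec : ∀ j → ℕ→ℚ (suc j) ℚ.* f (suc j) ≡ x ℚ.* f j)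
         (g-rec : ∀ j → ℕ→ℚ (suc j) ℚ.* g (suc j) ≡ y ℚ.* g j) where

  conv-rec : ∀ t → ℕ→ℚ (suc t) ℚ.* conv f g (suc t) ≡ (x ℚ.+ y) ℚ.* conv f g t
  conv-rec t = begin
    K ℚ.* ∑ (2 + t) h                   ≡⟨ ≡.sym (∑-*ˡ (2 + t) K h) ⟩
    ∑ (2 + t) (λ i → K ℚ.* h i)         ≡⟨ ∑-cong (2 + t) weight-split ⟩
    ∑ (2 + t) (λ i → a i ℚ.+ b i)       ≡⟨ ∑-distrib-+ (2 + t) a b ⟩
    ∑ (2 + t) a ℚ.+ ∑ (2 + t) b         ≡⟨ cong₂ ℚ._+_ ∑a ∑b ⟩
    x ℚ.* conv f g t ℚ.+ y ℚ.* conv f g t  ≡⟨ ≡.sym (ℚP.*-distribʳ-+ (conv f g t) x y) ⟩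
    (x ℚ.+ y) ℚ.* conv f g t            ∎
    where
    open ≡-Reasoning
    K : ℚ
    K = ℕ→ℚ (suc t)
    h a b : ℕ → ℚ
    h i = f i ℚ.* g (suc t ∸ i)
    a i = (ℕ→ℚ i ℚ.* f i) ℚ.* g (suc t ∸ i)
    b i = f i ℚ.* (ℕ→ℚ (suc t ∸ i) ℚ.* g (suc t ∸ i))

    weight-split : ∀ {i} → i < 2 + t → K ℚ.* h i ≡ a i ℚ.+ b i
    weight-split {i} i<2+t = begin
      K ℚ.* h i                                  ≡⟨ cong (λ k → ℕ→ℚ k ℚ.* h i) (≡.sym (ℕP.m+[n∸m]≡n (ℕP.≤-pred i<2+t))) ⟩
      ℕ→ℚ (i + (suc t ∸ i)) ℚ.* h i              ≡⟨ cong (ℚ._* h i) (ℕ→ℚ-homo-+ i (suc t ∸ i)) ⟩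
      (ℕ→ℚ i ℚ.+ ℕ→ℚ (suc t ∸ i)) ℚ.* h i        ≡⟨ solve 4 (λ p q u v → (p :+ q) :* (u :* v) := (p :* u) :* v :+ u :* (q :* v)) refl
                                                       (ℕ→ℚ i) (ℕ→ℚ (suc t ∸ i)) (f i) (g (suc t ∸ i)) ⟩
      a i ℚ.+ b i                                ∎
      where open +-*-Solver

    ∑a : ∑ (2 + t) a ≡ x ℚ.* conv f g t
    ∑a = begin
      ∑ (2 + t) a                                          ≡⟨ ∑-suc (suc t) a ⟩
      a 0 ℚ.+ ∑ (suc t) (λ i → a (suc i))                  ≡⟨ cong₂ ℚ._+_ a0≡0 (∑-cong (suc t) λ {i} _ → a-suc i) ⟩
      0ℚ ℚ.+ ∑ (suc t) (λ i → x ℚ.* (f i ℚ.* g (t ∸ i)))  ≡⟨ ℚP.+-identityˡ _ ⟩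
      ∑ (suc t) (λ i → x ℚ.* (f i ℚ.* g (t ∸ i)))          ≡⟨ ∑-*ˡ (suc t) x (λ i → f i ℚ.* g (t ∸ i)) ⟩
      x ℚ.* conv f g t                                     ∎
      where
      a0≡0 : a 0 ≡ 0ℚ
      a0≡0 = trans (cong (ℚ._* g (suc t)) (ℚP.*-zeroˡ (f 0))) (ℚP.*-zeroˡ (g (suc t)))
      a-suc : ∀ i → a (suc i) ≡ x ℚ.* (f i ℚ.* g (t ∸ i))
      a-suc i = trans (cong (ℚ._* g (t ∸ i)) (f-rec i)) (ℚP.*-assoc x (f i) (g (t ∸ i)))

    ∑b : ∑ (2 + t) b ≡ y ℚ.* conv f g t
    ∑b = begin
      ∑ (suc t) b ℚ.+ b (suc t)                            ≡⟨ cong₂ ℚ._+_ (∑-cong (suc t) b-<) b-last ⟩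
      ∑ (suc t) (λ i → y ℚ.* (f i ℚ.* g (t ∸ i))) ℚ.+ 0ℚ  ≡⟨ ℚP.+-identityʳ _ ⟩
      ∑ (suc t) (λ i → y ℚ.* (f i ℚ.* g (t ∸ i)))          ≡⟨ ∑-*ˡ (suc t) y (λ i → f i ℚ.* g (t ∸ i)) ⟩
      y ℚ.* conv f g t                                     ∎
      where
      b-last : b (suc t) ≡ 0ℚ
      b-last rewrite ℕP.n∸n≡0 t = trans (cong (f (suc t) ℚ.*_) (ℚP.*-zeroˡ (g 0))) (ℚP.*-zeroʳ (f (suc t)))
      b-< : ∀ {i} → i < suc t → b i ≡ y ℚ.* (f i ℚ.* g (t ∸ i))
      b-< {i} i<1+t rewrite ℕP.+-∸-assoc 1 (ℕP.≤-pred i<1+t) =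
        trans (cong (f i ℚ.*_) (g-rec (t ∸ i)))
              (solve 3 (λ u v w → u :* (v :* w) := v :* (u :* w)) refl (f i) y (g (t ∸ i)))
        where open +-*-Solver

conv-expTerm : ∀ x y t → conv (expTerm x) (expTerm y) t ≡ expTerm (x ℚ.+ y) t
conv-expTerm x y zero    = refl
conv-expTerm x y (suc t) = *-cancelˡ-≡-pos (ℕ→ℚ (suc t)) (ℕ→ℚ-pos t) (begin
  ℕ→ℚ (suc t) ℚ.* conv (expTerm x) (expTerm y) (suc t)  ≡⟨ conv-rec {expTerm x} {expTerm y} {x} {y} (expTerm-rec x) (expTerm-rec y) t ⟩
  (x ℚ.+ y) ℚ.* conv (expTerm x) (expTerm y) t          ≡⟨ cong ((x ℚ.+ y) ℚ.*_) (conv-expTerm x y t) ⟩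
  (x ℚ.+ y) ℚ.* expTerm (x ℚ.+ y) t                     ≡⟨ ≡.sym (expTerm-rec (x ℚ.+ y) t) ⟩
  ℕ→ℚ (suc t) ℚ.* expTerm (x ℚ.+ y) (suc t)             ∎)
  where open ≡-Reasoning

∑-triangle : ∀ (f g : ℕ → ℚ) N → ∑ N (λ i → f i ℚ.* ∑ (N ∸ i) g) ≡ ∑ N (conv f g)
∑-triangle f g zero    = refl
∑-triangle f g (suc N) = begin
  ∑ (suc N) (λ i → f i ℚ.* ∑ (suc N ∸ i) g)                    ≡⟨ ∑-cong (suc N) peel ⟩
  ∑ (suc N) (λ i → f i ℚ.* ∑ (N ∸ i) g ℚ.+ f i ℚ.* g (N ∸ i))  ≡⟨ ∑-distrib-+ (suc N) _ _ ⟩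
  ∑ N (λ i → f i ℚ.* ∑ (N ∸ i) g) ℚ.+ f N ℚ.* ∑ (N ∸ N) g ℚ.+ conv f g N
                                                               ≡⟨ cong (ℚ._+ conv f g N) earlier-rows ⟩
  ∑ N (conv f g) ℚ.+ conv f g N                                ∎
  where
  open ≡-Reasoning
  peel : ∀ {i} → i < suc N → f i ℚ.* ∑ (suc N ∸ i) g ≡ f i ℚ.* ∑ (N ∸ i) g ℚ.+ f i ℚ.* g (N ∸ i)
  peel {i} i<1+N rewrite ℕP.+-∸-assoc 1 (ℕP.≤-pred i<1+N) = ℚP.*-distribˡ-+ (f i) (∑ (N ∸ i) g) (g (N ∸ i))
  diagonal : f N ℚ.* ∑ (N ∸ N) g ≡ 0ℚ
  diagonal rewrite ℕP.n∸n≡0 N = ℚP.*-zeroʳ (f N)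
  earlier-rows : ∑ N (λ i → f i ℚ.* ∑ (N ∸ i) g) ℚ.+ f N ℚ.* ∑ (N ∸ N) g ≡ ∑ N (conv f g)
  earlier-rows = trans (cong₂ ℚ._+_ (∑-triangle f g N) diagonal) (ℚP.+-identityʳ (∑ N (conv f g)))

-- All terms are nonnegative and the rectangle i < m, j < p lies in the triangle i + j < m + p.
∑expTerm-*-≤ : ∀ {x y} → 0ℚ ℚ.≤ x → 0ℚ ℚ.≤ y → ∀ m p →
               ∑ m (expTerm x) ℚ.* ∑ p (expTerm y) ℚ.≤ ∑ (m + p) (expTerm (x ℚ.+ y))
∑expTerm-*-≤ {x} {y} 0≤x 0≤y m p = begin
  ∑ m f ℚ.* ∑ p g                               ≡⟨ ≡.sym (∑-*ʳ m (∑ p g) f) ⟩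
  ∑ m (λ i → f i ℚ.* ∑ p g)                     ≤⟨ ∑-mono-≤ m lengthen-rows ⟩
  ∑ m (λ i → f i ℚ.* ∑ (m + p ∸ i) g)           ≤⟨ ∑-monoˡ-≤ rows≥0 (ℕP.m≤m+n m p) ⟩
  ∑ (m + p) (λ i → f i ℚ.* ∑ (m + p ∸ i) g)     ≡⟨ ∑-triangle f g (m + p) ⟩
  ∑ (m + p) (conv f g)                          ≡⟨ ∑-cong (m + p) (λ {t} _ → conv-expTerm x y t) ⟩
  ∑ (m + p) (expTerm (x ℚ.+ y))                 ∎
  where
  open ℚP.≤-Reasoning
  f g : ℕ → ℚ
  f = expTerm x
  g = expTerm y
  lengthen-rows : ∀ {i} → i < m → f i ℚ.* ∑ p g ℚ.≤ f i ℚ.* ∑ (m + p ∸ i) g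
  lengthen-rows {i} i<m = ℚP.*-monoˡ-≤-nonNeg (f i) {{ℚ.nonNegative (expTerm-nonNeg 0≤x i)}}
    (∑-monoˡ-≤ (expTerm-nonNeg 0≤y) (subst (p ≤_) (≡.sym (ℕP.+-∸-comm p (ℕP.<⇒≤ i<m))) (ℕP.m≤n+m p (m ∸ i))))
  rows≥0 : ∀ i → 0ℚ ℚ.≤ f i ℚ.* ∑ (m + p ∸ i) g
  rows≥0 i = *-nonNeg (expTerm-nonNeg 0≤x i) (∑-nonNeg (m + p ∸ i) (expTerm-nonNeg 0≤y))

pow-∑expTerm-≤ : ∀ {y} → 0ℚ ℚ.≤ y → ∀ m k →
                 pow (∑ m (expTerm y)) (suc k) ℚ.≤ ∑ (suc k * m) (expTerm (ℕ→ℚ (suc k) ℚ.* y))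
pow-∑expTerm-≤ {y} 0≤y m zero = ℚP.≤-reflexive
  (trans (ℚP.*-identityʳ _) (cong₂ (λ l z → ∑ l (expTerm z)) (≡.sym (ℕP.+-identityʳ m)) (≡.sym (ℚP.*-identityˡ y))))
pow-∑expTerm-≤ {y} 0≤y m (suc k) = begin
  ∑ m e ℚ.* pow (∑ m e) (suc k)                               ≤⟨ ℚP.*-monoˡ-≤-nonNeg (∑ m e) {{∑m≥0}} (pow-∑expTerm-≤ 0≤y m k) ⟩
  ∑ m e ℚ.* ∑ (suc k * m) (expTerm (ℕ→ℚ (suc k) ℚ.* y))       ≤⟨ ∑expTerm-*-≤ 0≤y (*-nonNeg (ℕ→ℚ-nonNeg (suc k)) 0≤y) m (suc k * m) ⟩
  ∑ (suc (suc k) * m) (expTerm (y ℚ.+ ℕ→ℚ (suc k) ℚ.* y))     ≡⟨ cong (λ z → ∑ (suc (suc k) * m) (expTerm z)) y+ky≡[1+k]y ⟩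
  ∑ (suc (suc k) * m) (expTerm (ℕ→ℚ (suc (suc k)) ℚ.* y))     ∎
  where
  open ℚP.≤-Reasoning
  e : ℕ → ℚ
  e = expTerm y
  ∑m≥0 : ℚ.NonNegative (∑ m e)
  ∑m≥0 = ℚ.nonNegative (∑-nonNeg m (expTerm-nonNeg 0≤y))
  y+ky≡[1+k]y : y ℚ.+ ℕ→ℚ (suc k) ℚ.* y ≡ ℕ→ℚ (suc (suc k)) ℚ.* y
  y+ky≡[1+k]y = trans (solve 2 (λ y k → y :+ k :* y := (con 1ℚ :+ k) :* y) refl y (ℕ→ℚ (suc k)))
                      (cong (ℚ._* y) (≡.sym (ℕ→ℚ-homo-+ 1 (suc k))))
    where open +-*-Solver

ExpLe-antimono : ∀ {x y N} → 0ℚ ℚ.≤ x → x ℚ.≤ y → ExpLe y N → ExpLe x N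
ExpLe-antimono {x} {y} {N} 0≤x x≤y e^y≤N m = begin
  expPartial x m     ≡⟨ expPartial≡∑ x m ⟩
  ∑ m (expTerm x)    ≤⟨ ∑-mono-≤ m (λ {j} _ → expTerm-mono-≤ 0≤x x≤y j) ⟩
  ∑ m (expTerm y)    ≡⟨ ≡.sym (expPartial≡∑ y m) ⟩
  expPartial y m     ≤⟨ e^y≤N m ⟩
  ℕ→ℚ N              ∎
  where open ℚP.≤-Reasoning

ExpLe-root : ∀ {y} N k .{{_ : NonZero k}} → 0ℚ ℚ.≤ y → ExpLe (ℕ→ℚ k ℚ.* y) (N ^ k) → ExpLe y N
ExpLe-root {y} N (suc k) 0≤y e^ky≤N^k m with expPartial y m ℚP.≤? ℕ→ℚ N
... | yes e^y≤N = e^y≤N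
... | no  e^y≰N = ⊥-elim (ℚP.<-irrefl refl (begin-strict
  pow (ℕ→ℚ N) (suc k)                                  <⟨ pow-mono-< (ℕ→ℚ-nonNeg N) (ℚP.≰⇒> e^y≰N) k ⟩
  pow (expPartial y m) (suc k)                         ≡⟨ cong (λ z → pow z (suc k)) (expPartial≡∑ y m) ⟩
  pow (∑ m (expTerm y)) (suc k)                        ≤⟨ pow-∑expTerm-≤ 0≤y m k ⟩
  ∑ (suc k * m) (expTerm (ℕ→ℚ (suc k) ℚ.* y))          ≡⟨ ≡.sym (expPartial≡∑ _ (suc k * m)) ⟩
  expPartial (ℕ→ℚ (suc k) ℚ.* y) (suc k * m)           ≤⟨ e^ky≤N^k (suc k * m) ⟩
  ℕ→ℚ (N ^ suc k)                                      ≡⟨ ℕ→ℚ-homo-^ N (suc k) ⟩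
  pow (ℕ→ℚ N) (suc k)                                  ∎))
  where open ℚP.≤-Reasoning

-- Counting

module _ {A : Set} where

  count-mono : ∀ {p q : A → Bool} xs → (∀ {x} → x ∈ xs → T (p x) → T (q x)) → count p xs ≤ count q xs
  count-mono []       p⇒q = z≤n
  count-mono {p} {q} (x ∷ xs) p⇒q with p x in px | q x in qx
  ... | true  | true  = s≤s (count-mono xs (p⇒q ∘ there))
  ... | true  | false = ⊥-elim (subst T qx (p⇒q (here refl) (Equivalence.from T-≡ px)))
  ... | false | true  = ℕP.m≤n⇒m≤1+n (count-mono xs (p⇒q ∘ there))
  ... | false | false = count-mono xs (p⇒q ∘ there)

  count-mono-< : ∀ {p q : A → Bool} xs → (∀ {x} → x ∈ xs → T (p x) → T (q x)) →
                 ∀ {y} → y ∈ xs → ¬ T (p y) → T (q y) → count p xs < count q xs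
  count-mono-< {p} {q} (x ∷ xs) p⇒q (here refl) ¬py qy with p x | q x
  ... | true  | _     = ⊥-elim (¬py tt)
  ... | false | true  = s≤s (count-mono xs (p⇒q ∘ there))
  count-mono-< {p} {q} (x ∷ xs) p⇒q (there y∈xs) ¬py qy with p x in px | q x in qx
  ... | true  | true  = s≤s (count-mono-< xs (p⇒q ∘ there) y∈xs ¬py qy)
  ... | true  | false = ⊥-elim (subst T qx (p⇒q (here refl) (Equivalence.from T-≡ px)))
  ... | false | true  = ℕP.m≤n⇒m≤1+n (count-mono-< xs (p⇒q ∘ there) y∈xs ¬py qy)
  ... | false | false = count-mono-< xs (p⇒q ∘ there) y∈xs ¬py qy

  count-∨ : ∀ (p q : A → Bool) xs → count (λ x → p x ∨ q x) xs ≤ count p xs + count q xs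
  count-∨ p q []       = z≤n
  count-∨ p q (x ∷ xs) with p x | q x
  ... | true  | true  = s≤s (ℕP.≤-trans (count-∨ p q xs) (ℕP.+-monoʳ-≤ (count p xs) (ℕP.n≤1+n _)))
  ... | true  | false = s≤s (count-∨ p q xs)
  ... | false | true  = subst (suc (count (λ x → p x ∨ q x) xs) ≤_) (≡.sym (ℕP.+-suc (count p xs) (count q xs))) (s≤s (count-∨ p q xs))
  ... | false | false = count-∨ p q xs

  count-false : ∀ xs → count (λ (_ : A) → false) xs ≡ 0
  count-false []       = refl
  count-false (x ∷ xs) = count-false xs

  count-pos⇒∃ : ∀ {p : A → Bool} xs → 0 < count p xs → ∃ λ x → x ∈ xs × T (p x)
  count-pos⇒∃ {p} (x ∷ xs) 0<count with p x in px
  ... | true  = x , here refl , Equivalence.from T-≡ px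
  ... | false = Product.map₂ (Product.map₁ there) (count-pos⇒∃ xs 0<count)

  count-≤-from-witness : ∀ {p : A → Bool} xs {K} → (∀ {x} → x ∈ xs → T (p x) → count p xs ≤ K) → count p xs ≤ K
  count-≤-from-witness {p} xs bound with count p xs ℕP.≟ 0
  ... | yes count≡0 = subst (_≤ _) (≡.sym count≡0) z≤n
  ... | no  count≢0 with count-pos⇒∃ xs (ℕP.n≢0⇒n>0 count≢0)
  ...   | x , x∈xs , px = bound x∈xs px

  count-any-≤ : ∀ {C : Set} (p : C → Bool) (q : C → A → Bool) ys xs {K} →
                (∀ y → T (p y) → count (q y) xs ≤ K) →
                count (λ x → any (λ y → p y ∧ q y x) ys) xs ≤ count p ys * K
  count-any-≤ p q []       xs q≤K = ℕP.≤-reflexive (count-false xs)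
  count-any-≤ p q (y ∷ ys) xs q≤K with p y in py
  ... | true  = ℕP.≤-trans (count-∨ (q y) _ xs) (ℕP.+-mono-≤ (q≤K y (Equivalence.from T-≡ py)) (count-any-≤ p q ys xs q≤K))
  ... | false = count-any-≤ p q ys xs q≤K

T-not⁺ : ∀ {b} → ¬ T b → T (not b)
T-not⁺ {false} _  = tt
T-not⁺ {true}  ¬t = ¬t tt

T-not⁻ : ∀ {b} → T (not b) → ¬ T b
T-not⁻ {false} _ ()

module _ {n : ℕ} where

  ==-refl : (x : Fin n) → T (x == x)
  ==-refl x with x Fin.≟ x
  ... | yes _   = tt
  ... | no  x≢x = x≢x refl

  ==⇒≡ : {x y : Fin n} → T (x == y) → x ≡ y
  ==⇒≡ {x} {y} x==y with x Fin.≟ y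
  ... | yes x≡y = x≡y

  ≢⇒not-== : {x y : Fin n} → x ≢ y → T (not (x == y))
  ≢⇒not-== {x} {y} x≢y = T-not⁺ (x≢y ∘ ==⇒≡)

  any-allFin-∧⁺ : ∀ (p q : Fin n → Bool) y → T (p y) → T (q y) → T (any (λ x → p x ∧ q x) (allFin n))
  any-allFin-∧⁺ p q y py qy = any⁺ _ (lose (∈-allFin y) (Equivalence.from T-∧ (py , qy)))

  count-unique-≤ : ∀ {p q : Fin n → Bool} {xs} → Unique xs →
                   (∀ {x} → x ∈ xs → T (p x) → T (q x)) → count p xs ≤ count q (allFin n)
  count-unique-≤ {xs = []} _ _ = z≤n
  count-unique-≤ {p} {q} {x ∷ xs} (x∉xs ∷ unique) p⇒q with p x in px
  ... | false = count-unique-≤ unique (p⇒q ∘ there)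
  ... | true  = ℕP.<-≤-trans (s≤s (count-unique-≤ unique q′-on-xs))
                  (count-mono-< (allFin n) (λ _ → proj₁ ∘ Equivalence.to T-∧) (∈-allFin x) ¬q′x qx)
    where
    q′ : Fin n → Bool
    q′ y = q y ∧ not (y == x)
    qx : T (q x)
    qx = p⇒q (here refl) (Equivalence.from T-≡ px)
    ¬q′x : ¬ T (q′ x)
    ¬q′x q′x = T-not⁻ (proj₂ (Equivalence.to T-∧ q′x)) (==-refl x)
    q′-on-xs : ∀ {y} → y ∈ xs → T (p y) → T (q′ y)
    q′-on-xs y∈xs py = Equivalence.from T-∧ (p⇒q (there y∈xs) py , ≢⇒not-== (≢-sym (All.lookup x∉xs y∈xs)))

count-upTo : ∀ {p : ℕ → Bool} {k} → (∀ {j} → T (p j) ⇔ j < k) → ∀ N → count p (upTo N) ≡ N ℕ.⊓ k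
count-upTo p⇔<k zero    = refl
count-upTo {p} {k} p⇔<k (suc N) = begin
  count p (upTo (suc N))                         ≡⟨ cong (count p) (≡.sym (LP.upTo-∷ʳ N)) ⟩
  count p (upTo N ++ N ∷ [])                     ≡⟨ cong length (LP.filter-++ (λ j → T? (p j)) (upTo N) (N ∷ [])) ⟩
  length (filter (λ j → T? (p j)) (upTo N) ++ filter (λ j → T? (p j)) (N ∷ []))
                                                 ≡⟨ LP.length-++ (filter (λ j → T? (p j)) (upTo N)) ⟩
  count p (upTo N) + count p (N ∷ [])            ≡⟨ cong (_+ count p (N ∷ [])) (count-upTo p⇔<k N) ⟩
  N ℕ.⊓ k + count p (N ∷ [])                     ≡⟨ last-step ⟩
  suc N ℕ.⊓ k                                    ∎
  where
  open ≡-Reasoning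
  last-step : N ℕ.⊓ k + count p (N ∷ []) ≡ suc N ℕ.⊓ k
  last-step with p N in pN | ℕP.<-≤-connex N k
  ... | true  | inj₁ N<k rewrite ℕP.m≤n⇒m⊓n≡m (ℕP.<⇒≤ N<k) | ℕP.m≤n⇒m⊓n≡m N<k = ℕP.+-comm N 1
  ... | true  | inj₂ k≤N = ⊥-elim (ℕP.<⇒≱ (Equivalence.to p⇔<k (Equivalence.from T-≡ pN)) k≤N)
  ... | false | inj₁ N<k = ⊥-elim (subst T pN (Equivalence.from p⇔<k N<k))
  ... | false | inj₂ k≤N rewrite ℕP.m≥n⇒m⊓n≡n k≤N | ℕP.m≥n⇒m⊓n≡n (ℕP.m≤n⇒m≤1+n k≤N) = ℕP.+-identityʳ k

-- Walks and distances

module Walks {n : ℕ} (G : Graph n) where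

  -- A record rather than T (reach G k u v), so that k, u and v can be inferred from a proof.
  record Reach (k : ℕ) (u v : Fin n) : Set where
    constructor reached
    field reached⁻ : T (reach G k u v)

  open Reach public

  Adj : Fin n → Fin n → Set
  Adj u v = T (adj G u v)

  reach-refl : ∀ u → Reach 0 u u
  reach-refl u = reached (==-refl u)

  reach-zero⁻ : ∀ {u v} → Reach 0 u v → u ≡ v
  reach-zero⁻ (reached r) = ==⇒≡ r

  reach-suc⁺ : ∀ {k u v} → Reach k u v → Reach (suc k) u v
  reach-suc⁺ (reached r) = reached (Equivalence.from T-∨ (inj₁ r))

  reach-step : ∀ {k u w v} → Reach k u w → Adj w v → Reach (suc k) u v
  reach-step {k} {u} {w} {v} (reached r) a = reached (Equivalence.from T-∨ (inj₂ (any-allFin-∧⁺ (reach G k u) (λ x → adj G x v) w r a)))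

  reach-suc⁻ : ∀ {k u v} → Reach (suc k) u v → Reach k u v ⊎ ∃ λ w → Reach k u w × Adj w v
  reach-suc⁻ (reached r) with Equivalence.to T-∨ r
  ... | inj₁ r′ = inj₁ (reached r′)
  ... | inj₂ r′ with satisfied (any⁻ _ (allFin n) r′)
  ...   | w , r∧a = inj₂ (w , Product.map₁ reached (Equivalence.to T-∧ r∧a))

  reach-mono : ∀ {j k u v} → j ≤ k → Reach j u v → Reach k u v
  reach-mono j≤k = go (ℕP.≤⇒≤′ j≤k)
    where
    go : ∀ {j k u v} → j ℕ.≤′ k → Reach j u v → Reach k u v
    go ℕ.≤′-refl         r = r
    go (ℕ.≤′-step j≤′k) r = reach-suc⁺ (go j≤′k r)

  reach-+ : ∀ {j} k {u v w} → Reach j u v → Reach k v w → Reach (j + k) u w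
  reach-+ {j} zero {u} r r′ = subst₂ (λ i x → Reach i u x) (≡.sym (ℕP.+-identityʳ j)) (reach-zero⁻ r′) r
  reach-+ {j} (suc k) {u} {v} {w} r r′ = subst (λ i → Reach i u w) (≡.sym (ℕP.+-suc j k)) (extend (reach-suc⁻ r′))
    where
    extend : Reach k v w ⊎ ∃ (λ x → Reach k v x × Adj x w) → Reach (suc (j + k)) u w
    extend (inj₁ r″)            = reach-suc⁺ (reach-+ k r r″)
    extend (inj₂ (x , r″ , a)) = reach-step (reach-+ k r r″) a

  reach-sym : ∀ k {u v} → Reach k u v → Reach k v u
  reach-sym zero    {u} r = subst (λ x → Reach 0 x u) (reach-zero⁻ r) (reach-refl u)
  reach-sym (suc k) {v = v} r with reach-suc⁻ r
  ... | inj₁ r′           = reach-suc⁺ (reach-sym k r′)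
  ... | inj₂ (w , r′ , a) = reach-+ k (reach-step (reach-refl v) (subst T (Graph.sym G w v) a)) (reach-sym k r′)

  FirstReachedAt : ℕ → Fin n → Fin n → Set
  FirstReachedAt k u v = Reach k u v × (∀ {j} → j < k → ¬ Reach j u v)

  firstReachedAt-∃ : ∀ k {u v} → Reach k u v → ∃ λ m → FirstReachedAt m u v
  firstReachedAt-∃ zero    r = 0 , r , λ ()
  firstReachedAt-∃ (suc k) {u} {v} r with T? (reach G k u v)
  ... | yes r′ = firstReachedAt-∃ k (reached r′)
  ... | no ¬r′ = suc k , r , λ j<1+k r″ → ¬r′ (reached⁻ (reach-mono (ℕP.≤-pred j<1+k) r″))

  firstReachedAt-parent : ∀ {k u v} → FirstReachedAt (suc k) u v → ∃ λ w → Adj w v × FirstReachedAt k u w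
  firstReachedAt-parent (r , first) with reach-suc⁻ r
  ... | inj₁ r′           = ⊥-elim (first ℕP.≤-refl r′)
  ... | inj₂ (w , r′ , a) = w , a , r′ , λ j<k r″ → first (s≤s j<k) (reach-step r″ a)

  ball : ℕ → Fin n → ℕ
  ball k u = count (reach G k u) (allFin n)

  -- Each step of a shortest walk enlarges the ball, so the first-reaching time is below n
  -- and δ, which only counts k < n, is the graph distance.
  firstReachedAt-<-ball : ∀ k {u v} → FirstReachedAt k u v → k < ball k u
  firstReachedAt-<-ball zero    {u} _ = LP.filter-some (λ x → T? (reach G 0 u x)) (lose (∈-allFin u) (==-refl u))
  firstReachedAt-<-ball (suc k) {u} {v} (r , first) with firstReachedAt-parent (r , first)
  ... | _ , _ , fr = ℕP.≤-trans (s≤s (firstReachedAt-<-ball k fr))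
                       (count-mono-< (allFin n) (λ _ r′ → reached⁻ (reach-suc⁺ {k} {u} (reached r′)))
                                     (∈-allFin v) (first ℕP.≤-refl ∘ reached) (reached⁻ r))

  firstReachedAt-<n : ∀ {k u v} → FirstReachedAt k u v → k < n
  firstReachedAt-<n {k} {u} fr = ℕP.<-≤-trans (firstReachedAt-<-ball k fr)
    (ℕP.≤-trans (LP.length-filter (λ x → T? (reach G k u x)) (allFin n)) (ℕP.≤-reflexive (LP.length-tabulate id)))

  firstReachedAt⇒δ : ∀ {k u v} → FirstReachedAt k u v → δ G u v ≡ k
  firstReachedAt⇒δ {k} {u} {v} (r , first) =
    trans (count-upTo unreached⇔<k n) (ℕP.m≥n⇒m⊓n≡n (ℕP.<⇒≤ (firstReachedAt-<n (r , first))))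
    where
    unreached⇔<k : ∀ {j} → T (not (reach G j u v)) ⇔ j < k
    unreached⇔<k = mk⇔ (λ ¬r → ℕP.≰⇒> (λ k≤j → T-not⁻ ¬r (reached⁻ (reach-mono k≤j r))))
                       (λ j<k → T-not⁺ (first j<k ∘ reached))

  module Distance (connected : Connected G) where

    δ-firstReachedAt : ∀ u v → FirstReachedAt (δ G u v) u v
    δ-firstReachedAt u v with connected u v
    ... | k , r with firstReachedAt-∃ k (reached (Equivalence.from T-≡ r))
    ...   | _ , fr = subst (λ i → FirstReachedAt i u v) (≡.sym (firstReachedAt⇒δ fr)) fr

    reach-δ : ∀ u v → Reach (δ G u v) u v
    reach-δ u v = proj₁ (δ-firstReachedAt u v)

    δ-≤ : ∀ {k u v} → Reach k u v → δ G u v ≤ k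
    δ-≤ {u = u} {v} r = ℕP.≮⇒≥ (λ k<δ → proj₂ (δ-firstReachedAt u v) k<δ r)

    δ-triangle : ∀ u v w → δ G u w ≤ δ G u v + δ G v w
    δ-triangle u v w = δ-≤ (reach-+ (δ G v w) (reach-δ u v) (reach-δ v w))

    δ-sym : ∀ u v → δ G u v ≡ δ G v u
    δ-sym u v = ℕP.≤-antisym (δ-≤ (reach-sym _ (reach-δ v u))) (δ-≤ (reach-sym _ (reach-δ u v)))

    δ-refl : ∀ u → δ G u u ≡ 0
    δ-refl u = ℕP.n≤0⇒n≡0 (δ-≤ (reach-refl u))

    δ-adj : ∀ {u v} → Adj u v → δ G u v ≤ 1
    δ-adj {u} a = δ-≤ (reach-step (reach-refl u) a)

    δ≡0⇒≡ : ∀ {u v} → δ G u v ≡ 0 → u ≡ v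
    δ≡0⇒≡ {u} {v} δ≡0 = reach-zero⁻ (subst (λ i → Reach i u v) δ≡0 (reach-δ u v))

    δ-parent : ∀ {k u v} → δ G u v ≡ suc k → ∃ λ w → Adj w v × δ G u w ≡ k
    δ-parent {u = u} {v} δ≡1+k with firstReachedAt-parent (subst (λ i → FirstReachedAt i u v) δ≡1+k (δ-firstReachedAt u v))
    ... | w , a , fr = w , a , firstReachedAt⇒δ fr

    geodesic : ∀ t k {u v} → δ G u v ≡ t + k → ∃ λ w → δ G u w ≡ t × δ G w v ≡ k
    geodesic t k {u} {v} δ≡t+k with geodesic-≤ k δ≡t+k
      where
      geodesic-≤ : ∀ k {v} → δ G u v ≡ t + k → ∃ λ w → δ G u w ≡ t × δ G w v ≤ k
      geodesic-≤ zero    {v} δ≡t+0 = v , trans δ≡t+0 (ℕP.+-identityʳ t) , ℕP.≤-reflexive (δ-refl v)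
      geodesic-≤ (suc k) {v} δ≡t+1+k with δ-parent (trans δ≡t+1+k (ℕP.+-suc t k))
      ... | p , a , δup≡t+k with geodesic-≤ k δup≡t+k
      ...   | w , δuw≡t , δwp≤k = w , δuw≡t ,
              ℕP.≤-trans (δ-triangle w p v) (ℕP.≤-trans (ℕP.+-mono-≤ δwp≤k (δ-adj a)) (ℕP.≤-reflexive (ℕP.+-comm k 1)))
    ... | w , δuw≡t , δwv≤k = w , δuw≡t , ℕP.≤-antisym δwv≤k (ℕP.+-cancelˡ-≤ t k (δ G w v) (begin
      t + k              ≡⟨ ≡.sym δ≡t+k ⟩
      δ G u v            ≤⟨ δ-triangle u w v ⟩
      δ G u w + δ G w v  ≡⟨ cong (_+ δ G w v) δuw≡t ⟩
      t + δ G w v        ∎))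
      where open ℕP.≤-Reasoning

-- Bad pairs

2≤∣n-m∣ : ∀ {m n} → m + 2 ≤ n → 2 ≤ ℕ.∣ n - m ∣
2≤∣n-m∣ {m} {n} m+2≤n = subst (2 ≤_) (≡.sym (ℕP.m≤n⇒∣n-m∣≡n∸m (ℕP.≤-trans (ℕP.m≤m+n m 2) m+2≤n)))
                              (ℕP.m+n≤o⇒m≤o∸n 2 (subst (_≤ n) (ℕP.+-comm m 2) m+2≤n))

midpoint-index : ∀ d → 3 ≤ d → ∃ λ i → i + 3 ≤ d × i + i + 2 ≤ d × d + 2 ≤ (i + 3) + (i + 3)
midpoint-index 1 (s≤s ())
midpoint-index 2 (s≤s (s≤s ()))
midpoint-index 3 _ = 0 , ℕP.≤-refl , ℕP.n≤1+n 2 , ℕP.n≤1+n 5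
midpoint-index 4 _ = 0 , ℕP.n≤1+n 3 , ℕP.m≤n+m 2 2 , ℕP.≤-refl
midpoint-index (suc (suc (suc (suc (suc d))))) _ with midpoint-index (3 + d) (s≤s (s≤s (s≤s z≤n)))
... | i , i+3≤d , i+i+2≤d , d+2≤2[i+3] = suc i ,
      ℕP.m≤n⇒m≤1+n (s≤s i+3≤d) ,
      subst (_≤ 5 + d) (cong (λ j → suc j + 2) (≡.sym (ℕP.+-suc i i))) (s≤s (s≤s i+i+2≤d)) ,
      subst (5 + (d + 2) ≤_) (cong suc (≡.sym (ℕP.+-suc (i + 3) (i + 3)))) (s≤s (s≤s d+2≤2[i+3]))

count-arith : ∀ Δ {C M} → suc C ≤ M → Δ ^ 2 + C * (Δ ^ 3 * M) ≤ Δ ^ 3 * (M * M)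
count-arith Δ {C} {suc M} 1+C≤M = begin
  Δ ^ 2 + C * (Δ ^ 3 * suc M)           ≤⟨ ℕP.+-monoˡ-≤ (C * (Δ ^ 3 * suc M)) (Δ²≤Δ³[1+M] Δ) ⟩
  suc C * (Δ ^ 3 * suc M)               ≤⟨ ℕP.*-monoˡ-≤ (Δ ^ 3 * suc M) 1+C≤M ⟩
  suc M * (Δ ^ 3 * suc M)               ≡⟨ solve 2 (λ m d → m :* (d :* m) := d :* (m :* m)) refl (suc M) (Δ ^ 3) ⟩
  Δ ^ 3 * (suc M * suc M)               ∎
  where
  open ℕP.≤-Reasoning
  open NatSolver
  Δ²≤Δ³[1+M] : ∀ Δ → Δ ^ 2 ≤ Δ ^ 3 * suc M
  Δ²≤Δ³[1+M] zero     = z≤n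
  Δ²≤Δ³[1+M] (suc Δ′) = ℕP.≤-trans (ℕP.m≤n*m (suc Δ′ ^ 2) (suc Δ′)) (ℕP.m≤m*n (suc Δ′ ^ 3) (suc M))

module BadPairs {n : ℕ} (G : Graph n) (connected : Connected G) {Δ : ℕ} (Δ-max : MaxDegreeAtMost G Δ) where

  open Walks G
  open Distance connected

  sphere : Fin n → ℕ → Fin n → Bool
  sphere y k x = δ G y x ℕ.≡ᵇ k

  sphere-size : ∀ k y → count (sphere y (suc k)) (allFin n) ≤ Δ ^ suc k
  sphere-size zero y = ℕP.≤-trans (count-mono (allFin n) (λ _ → neighbour))
                                  (ℕP.≤-trans (Δ-max y) (ℕP.≤-reflexive (≡.sym (ℕP.*-identityʳ Δ))))
    where
    neighbour : ∀ {x} → T (sphere y 1 x) → Adj y x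
    neighbour {x} δyx≡1 with δ-parent (ℕP.≡ᵇ⇒≡ _ 1 δyx≡1)
    ... | w , a , δyw≡0 = subst (λ z → Adj z x) (≡.sym (δ≡0⇒≡ δyw≡0)) a
  sphere-size (suc k) y = begin
    count (sphere y (2 + k)) (allFin n)                                              ≤⟨ count-mono (allFin n) (λ _ → has-parent) ⟩
    count (λ x → any (λ w → sphere y (suc k) w ∧ adj G w x) (allFin n)) (allFin n)  ≤⟨ count-any-≤ (sphere y (suc k)) (adj G) (allFin n) (allFin n) (λ w _ → Δ-max w) ⟩
    count (sphere y (suc k)) (allFin n) * Δ                                          ≤⟨ ℕP.*-monoˡ-≤ Δ (sphere-size k y) ⟩
    Δ ^ suc k * Δ                                                                    ≡⟨ ℕP.*-comm (Δ ^ suc k) Δ ⟩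
    Δ ^ (2 + k)                                                                      ∎
    where
    open ℕP.≤-Reasoning
    has-parent : ∀ {x} → T (sphere y (2 + k) x) → T (any (λ w → sphere y (suc k) w ∧ adj G w x) (allFin n))
    has-parent δyx≡2+k with δ-parent (ℕP.≡ᵇ⇒≡ _ (2 + k) δyx≡2+k)
    ... | w , a , δyw≡1+k = any-allFin-∧⁺ (sphere y (suc k)) (λ w → adj G w _) w (ℕP.≡⇒≡ᵇ _ _ δyw≡1+k) a

  distinguishes⁺ : ∀ {u a b} → δ G u b + 2 ≤ δ G u a → T (distinguishes G u a b)
  distinguishes⁺ = ℕP.≤⇒≤ᵇ ∘ 2≤∣n-m∣

  distinguishes⁺′ : ∀ {u a b} → δ G u a + 2 ≤ δ G u b → T (distinguishes G u a b)
  distinguishes⁺′ {u} {a} {b} = ℕP.≤⇒≤ᵇ ∘ subst (2 ≤_) (ℕP.∣-∣-comm (δ G u b) (δ G u a)) ∘ 2≤∣n-m∣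

  Bad : ℕ → Fin n → Fin n → Set
  Bad M a b = 2 ≤ δ G a b × ∣D∣ G a b ≤ M

  module _ (a : Fin n) where

    close : Fin n → Fin n → Bool
    close c y = δ G a y + δ G a y + 2 ℕ.≤ᵇ δ G a c

    pastMidpoint : Fin n → Fin n → Bool
    pastMidpoint z x = (δ G a z + δ G z x ℕ.≡ᵇ δ G a x) ∧ (δ G a x + 2 ℕ.≤ᵇ δ G a z + δ G a z)

    close-distinguishes : ∀ {c y} → T (close c y) → T (distinguishes G y a c)
    close-distinguishes {c} {y} close-y = distinguishes⁺′ (subst (λ d → d + 2 ≤ δ G y c) (δ-sym a y)
      (ℕP.+-cancelˡ-≤ (δ G a y) _ _ (begin
        δ G a y + (δ G a y + 2)  ≡⟨ ≡.sym (ℕP.+-assoc (δ G a y) (δ G a y) 2) ⟩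
        δ G a y + δ G a y + 2    ≤⟨ ℕP.≤ᵇ⇒≤ _ _ close-y ⟩
        δ G a c                  ≤⟨ δ-triangle a y c ⟩
        δ G a y + δ G y c        ∎)))
      where open ℕP.≤-Reasoning

    pastMidpoint-distinguishes : ∀ {z x b} → T (pastMidpoint z x) → T (pastMidpoint z b) → T (distinguishes G x a b)
    pastMidpoint-distinguishes {z} {x} {b} past-x past-b = distinguishes⁺ (begin
      δ G x b + 2                 ≤⟨ ℕP.+-monoˡ-≤ 2 (subst (λ d → δ G x b ≤ d + δ G z b) (δ-sym x z) (δ-triangle x z b)) ⟩
      δ G z x + δ G z b + 2       ≡⟨ ℕP.+-assoc (δ G z x) (δ G z b) 2 ⟩
      δ G z x + (δ G z b + 2)     ≤⟨ ℕP.+-monoʳ-≤ (δ G z x) δzb+2≤δaz ⟩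
      δ G z x + δ G a z           ≡⟨ ℕP.+-comm (δ G z x) (δ G a z) ⟩
      δ G a z + δ G z x           ≡⟨ ℕP.≡ᵇ⇒≡ _ _ (proj₁ (Equivalence.to T-∧ past-x)) ⟩
      δ G a x                     ≡⟨ δ-sym a x ⟩
      δ G x a                     ∎)
      where
      open ℕP.≤-Reasoning
      past-b′ : T (δ G a z + δ G z b ℕ.≡ᵇ δ G a b) × T (δ G a b + 2 ℕ.≤ᵇ δ G a z + δ G a z)
      past-b′ = Equivalence.to T-∧ past-b
      δzb+2≤δaz : δ G z b + 2 ≤ δ G a z
      δzb+2≤δaz = ℕP.+-cancelˡ-≤ (δ G a z) _ _ (begin
        δ G a z + (δ G z b + 2)  ≡⟨ ≡.sym (ℕP.+-assoc (δ G a z) (δ G z b) 2) ⟩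
        δ G a z + δ G z b + 2    ≡⟨ cong (_+ 2) (ℕP.≡ᵇ⇒≡ _ _ (proj₁ past-b′)) ⟩
        δ G a b + 2              ≤⟨ ℕP.≤ᵇ⇒≤ _ _ (proj₂ past-b′) ⟩
        δ G a z + δ G a z        ∎)

    count-close : ∀ {c} → 2 ≤ δ G a c → count (close c) (allFin n) < ∣D∣ G a c
    count-close {c} 2≤δac = count-mono-< (allFin n) (λ _ → close-distinguishes) (∈-allFin c) ¬close-c c-distinguishes
      where
      d : ℕ
      d = δ G a c
      ¬close-c : ¬ T (close c c)
      ¬close-c close-c = ℕP.<⇒≱ (ℕP.≤-<-trans (ℕP.m≤m+n d d) (ℕP.m<m+n (d + d) (s≤s z≤n))) (ℕP.≤ᵇ⇒≤ _ _ close-c)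
      c-distinguishes : T (distinguishes G c a c)
      c-distinguishes = distinguishes⁺ (subst₂ (λ p q → p + 2 ≤ q) (≡.sym (δ-refl c)) (δ-sym a c) 2≤δac)

    count-pastMidpoint : ∀ {M bs} → Unique bs → All (Bad M a) bs → ∀ z → count (pastMidpoint z) bs ≤ M
    count-pastMidpoint {M} {bs} unique bad z = count-≤-from-witness bs λ b∈bs past-b →
      ℕP.≤-trans (count-unique-≤ unique (λ _ past-x → pastMidpoint-distinguishes past-x past-b)) (proj₂ (All.lookup bad b∈bs))

    -- z is the vertex at distance ⌈δ(a,x)/2⌉ + 1 from a on a geodesic to x, y lies three steps before z.
    route : ∀ {c x} → 3 ≤ δ G a x → δ G a x ≤ δ G a c →
            ∃ λ y → T (close c y) × ∃ λ z → T (sphere y 3 z) × T (pastMidpoint z x)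
    route {c} {x} 3≤δax δax≤δac =
      let i , i+3≤δax , i+i+2≤δax , δax+2≤2[i+3] = midpoint-index (δ G a x) 3≤δax
          z , δaz≡i+3 , δzx≡δax∸[i+3] = geodesic (i + 3) (δ G a x ∸ (i + 3)) (≡.sym (ℕP.m+[n∸m]≡n i+3≤δax))
          y , δay≡i , δyz≡3 = geodesic i 3 δaz≡i+3
          close-y : T (close c y)
          close-y = ℕP.≤⇒≤ᵇ (subst (λ j → j + j + 2 ≤ δ G a c) (≡.sym δay≡i) (ℕP.≤-trans i+i+2≤δax δax≤δac))
          on-geodesic : T (δ G a z + δ G z x ℕ.≡ᵇ δ G a x)
          on-geodesic = ℕP.≡⇒≡ᵇ _ _ (trans (cong₂ _+_ δaz≡i+3 δzx≡δax∸[i+3]) (ℕP.m+[n∸m]≡n i+3≤δax))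
          past-midpoint : T (δ G a x + 2 ℕ.≤ᵇ δ G a z + δ G a z)
          past-midpoint = ℕP.≤⇒≤ᵇ (subst (λ j → δ G a x + 2 ≤ j + j) (≡.sym δaz≡i+3) δax+2≤2[i+3])
      in y , close-y , z , ℕP.≡⇒≡ᵇ _ 3 δyz≡3 , Equivalence.from T-∧ (on-geodesic , past-midpoint)

    far : Fin n → Bool
    far x = 3 ℕ.≤ᵇ δ G a x

    count-far : ∀ {M c bs} → Unique bs → All (Bad M a) bs → (∀ {x} → x ∈ bs → δ G a x ≤ δ G a c) →
                count far bs ≤ count (close c) (allFin n) * (Δ ^ 3 * M)
    count-far {M} {c} {bs} unique bad ≤δac = begin
      count far bs                                                  ≤⟨ count-mono bs routed ⟩
      count (λ x → any (λ y → close c y ∧ via y x) (allFin n)) bs  ≤⟨ count-any-≤ (close c) via (allFin n) bs (λ y _ → count-via y) ⟩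
      count (close c) (allFin n) * (Δ ^ 3 * M)                      ∎
      where
      open ℕP.≤-Reasoning
      via : Fin n → Fin n → Bool
      via y x = any (λ z → sphere y 3 z ∧ pastMidpoint z x) (allFin n)
      count-via : ∀ y → count (via y) bs ≤ Δ ^ 3 * M
      count-via y = ℕP.≤-trans (count-any-≤ (sphere y 3) pastMidpoint (allFin n) bs (λ z _ → count-pastMidpoint unique bad z))
                               (ℕP.*-monoˡ-≤ M (sphere-size 2 y))
      routed : ∀ {x} → x ∈ bs → T (far x) → T (any (λ y → close c y ∧ via y x) (allFin n))
      routed x∈bs 3≤δax =
        let y , close-y , z , δyz≡3 , past = route (ℕP.≤ᵇ⇒≤ 3 _ 3≤δax) (≤δac x∈bs)
        in any-allFin-∧⁺ (close c) (λ y → via y _) y close-y (any-allFin-∧⁺ (sphere y 3) (λ z → pastMidpoint z _) z δyz≡3 past)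

    bad-count : ∀ {M} bs → Unique bs → All (Bad M a) bs → length bs ≤ Δ ^ 3 * (M * M)
    bad-count      []       _      _   = z≤n
    bad-count {M} (b ∷ bs) unique bad = begin
      length (b ∷ bs)                                            ≡⟨ cong length (≡.sym (LP.filter-all (λ x → T? (near x ∨ far x)) (All.map near-or-far bad))) ⟩
      count (λ x → near x ∨ far x) (b ∷ bs)                      ≤⟨ count-∨ near far (b ∷ bs) ⟩
      count near (b ∷ bs) + count far (b ∷ bs)                   ≤⟨ ℕP.+-mono-≤ count-near (count-far unique bad ≤δac) ⟩
      Δ ^ 2 + count (close c) (allFin n) * (Δ ^ 3 * M)           ≤⟨ count-arith Δ (ℕP.<-≤-trans (count-close (proj₁ c-bad)) (proj₂ c-bad)) ⟩
      Δ ^ 3 * (M * M)                                            ∎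
      where
      open ℕP.≤-Reasoning
      near : Fin n → Bool
      near = sphere a 2
      near-or-far : ∀ {x} → Bad M a x → T (near x ∨ far x)
      near-or-far (2≤δax , _) with ℕP.m≤n⇒m<n∨m≡n 2≤δax
      ... | inj₁ 2<δax = Equivalence.from T-∨ (inj₂ (ℕP.≤⇒≤ᵇ 2<δax))
      ... | inj₂ 2≡δax = Equivalence.from T-∨ (inj₁ (ℕP.≡⇒≡ᵇ _ 2 (≡.sym 2≡δax)))
      count-near : count near (b ∷ bs) ≤ Δ ^ 2
      count-near = ℕP.≤-trans (count-unique-≤ unique (λ _ → id)) (sphere-size 1 a)
      c : Fin n
      c = argmax (δ G a) b bs
      c-bad : Bad M a c
      c-bad = argmax-all (δ G a) (All.head bad) (All.tail bad)
      ≤δac : ∀ {x} → x ∈ b ∷ bs → δ G a x ≤ δ G a c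
      ≤δac = All.lookup (f[⊥]≤f[argmax] {f = δ G a} b bs All.∷ f[xs]≤f[argmax] b bs)

square-cancel-≤ : ∀ {A u v} → 0ℚ ℚ.≤ A → 0ℚ ℚ.≤ v → A ℚ.* (u ℚ.* u) ℚ.< A ℚ.* (v ℚ.* v) → u ℚ.≤ v
square-cancel-≤ {A} {u} {v} 0≤A 0≤v Au²<Av² with ℚP.≤-total u v
... | inj₁ u≤v = u≤v
... | inj₂ v≤u = ⊥-elim (ℚP.<-irrefl refl (ℚP.<-≤-trans Au²<Av²
                   (ℚP.*-monoˡ-≤-nonNeg A {{ℚ.nonNegative 0≤A}} (*-mono-≤-nonNeg (ℚP.≤-trans 0≤v v≤u) 0≤v v≤u v≤u))))

ℕ→ℚ-*-square : ∀ a b → ℕ→ℚ (a * (b * b)) ≡ ℕ→ℚ a ℚ.* (ℕ→ℚ b ℚ.* ℕ→ℚ b)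
ℕ→ℚ-*-square a b = trans (ℕ→ℚ-homo-* a (b * b)) (cong (ℕ→ℚ a ℚ.*_) (ℕ→ℚ-homo-* b b))

9Δ³n²q²<s²L⇒3nq≤sM : ∀ Δ n s {L M q} → L ≤ Δ ^ 3 * (M * M) →
                      ℕ→ℚ (9 * Δ ^ 3 * n ^ 2) ℚ.* (q ℚ.* q) ℚ.< ℕ→ℚ (s ^ 2 * L) → ℕ→ℚ (3 * n) ℚ.* q ℚ.≤ ℕ→ℚ (s * M)
9Δ³n²q²<s²L⇒3nq≤sM Δ n s {L} {M} {q} L≤Δ³M² 9Δ³n²q²<s²L = square-cancel-≤ (ℕ→ℚ-nonNeg (Δ ^ 3)) (ℕ→ℚ-nonNeg (s * M)) (begin-strict
  ℕ→ℚ (Δ ^ 3) ℚ.* ((ℕ→ℚ (3 * n) ℚ.* q) ℚ.* (ℕ→ℚ (3 * n) ℚ.* q))  ≡⟨ ≡.sym 9Δ³n²q²≡Δ³[3nq]² ⟩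
  ℕ→ℚ (9 * Δ ^ 3 * n ^ 2) ℚ.* (q ℚ.* q)                           <⟨ 9Δ³n²q²<s²L ⟩
  ℕ→ℚ (s ^ 2 * L)                                                 ≤⟨ ℕ→ℚ-mono-≤ (ℕP.*-monoʳ-≤ (s ^ 2) L≤Δ³M²) ⟩
  ℕ→ℚ (s ^ 2 * (Δ ^ 3 * (M * M)))                                 ≡⟨ s²Δ³M²≡Δ³[sM]² ⟩
  ℕ→ℚ (Δ ^ 3) ℚ.* (ℕ→ℚ (s * M) ℚ.* ℕ→ℚ (s * M))                   ∎)
  where
  open ℚP.≤-Reasoning
  9Δ³n²≡Δ³[3n]² : 9 * Δ ^ 3 * n ^ 2 ≡ Δ ^ 3 * (3 * n * (3 * n))
  9Δ³n²≡Δ³[3n]² = solve 2 (λ d m → con 9 :* (d :* (d :* (d :* con 1))) :* (m :* (m :* con 1))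
                                   := (d :* (d :* (d :* con 1))) :* ((con 3 :* m) :* (con 3 :* m))) refl Δ n
    where open NatSolver
  9Δ³n²q²≡Δ³[3nq]² : ℕ→ℚ (9 * Δ ^ 3 * n ^ 2) ℚ.* (q ℚ.* q) ≡ ℕ→ℚ (Δ ^ 3) ℚ.* ((ℕ→ℚ (3 * n) ℚ.* q) ℚ.* (ℕ→ℚ (3 * n) ℚ.* q))
  9Δ³n²q²≡Δ³[3nq]² = trans
    (cong (ℚ._* (q ℚ.* q)) (trans (cong ℕ→ℚ 9Δ³n²≡Δ³[3n]²) (ℕ→ℚ-*-square (Δ ^ 3) (3 * n))))
    (solve 3 (λ a u q → (a :* (u :* u)) :* (q :* q) := a :* ((u :* q) :* (u :* q))) refl (ℕ→ℚ (Δ ^ 3)) (ℕ→ℚ (3 * n)) q)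
    where open +-*-Solver
  s²Δ³M²≡Δ³[sM]² : ℕ→ℚ (s ^ 2 * (Δ ^ 3 * (M * M))) ≡ ℕ→ℚ (Δ ^ 3) ℚ.* (ℕ→ℚ (s * M) ℚ.* ℕ→ℚ (s * M))
  s²Δ³M²≡Δ³[sM]² = trans
    (cong ℕ→ℚ (solve 3 (λ s d m → (s :* (s :* con 1)) :* (d :* (m :* m)) := d :* ((s :* m) :* (s :* m))) refl s (Δ ^ 3) M))
    (ℕ→ℚ-*-square (Δ ^ 3) (s * M))
    where open NatSolver

lemma24 : (n : ℕ) (G : Graph n) (Δ s : ℕ) → Connected G → MaxDegreeAtMost G Δ → 1 ≤ s
          → (a : Fin n) (bs : List (Fin n)) → Unique bs → All (InB G s a) bs
          → (q : ℚ) → 0ℚ ℚ.≤ q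
          → ℕ→ℚ (9 * Δ ^ 3 * n ^ 2) ℚ.* (q ℚ.* q) ℚ.< ℕ→ℚ (s ^ 2 * length bs)
          → ExpLe q n
lemma24 (suc n′) G Δ s _ _ _ a [] _ _ q 0≤q 9Δ³n²q²<s²·0 =
  ⊥-elim (ℚP.<-irrefl refl (ℚP.<-≤-trans (subst (_ ℚ.<_) (cong ℕ→ℚ (ℕP.*-zeroʳ (s ^ 2))) 9Δ³n²q²<s²·0)
                                         (*-nonNeg (ℕ→ℚ-nonNeg (9 * Δ ^ 3 * suc n′ ^ 2)) (*-nonNeg 0≤q 0≤q))))
lemma24 n@(suc _) G Δ s connected Δ-max _ a (b ∷ bs) unique InB-bs q 0≤q 9Δ³n²q²<s²|bs| =
  ExpLe-root n (3 * n) 0≤q (ExpLe-antimono {N = n ^ (3 * n)} (*-nonNeg (ℕ→ℚ-nonNeg (3 * n)) 0≤q)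
    (9Δ³n²q²<s²L⇒3nq≤sM Δ n s |bs|≤Δ³M² 9Δ³n²q²<s²|bs|) (proj₂ InB-c))
  where
  open BadPairs G connected Δ-max
  c : Fin n
  c = argmax (∣D∣ G a) b bs
  InB-c : InB G s a c
  InB-c = argmax-all (∣D∣ G a) (All.head InB-bs) (All.tail InB-bs)
  |bs|≤Δ³M² : length (b ∷ bs) ≤ Δ ^ 3 * (∣D∣ G a c * ∣D∣ G a c)
  |bs|≤Δ³M² = bad-count a (b ∷ bs) unique
    (All.zipWith (Product.map₁ proj₁) (InB-bs , f[⊥]≤f[argmax] {f = ∣D∣ G a} b bs All.∷ f[xs]≤f[argmax] b bs))
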